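{- Let $(V,E)$ be a (possibly infinite) connected interval graph. Let $W=\{(a,b)\in V\times V \mid \neg\, a\,E\,b\}$ and define a relation $Q$ on $W$ by $(a,b)\,Q\,(c,d)$ if and only if $a\,E\,c$ and $b\,E\,d$. Then the following are equivalent: (1) $(V,E)$ is uniquely orderable; (2) $(V,E)$ does not contain a buried subgraph; (3) the graph $(W,Q)$ has exactly two connected components.
   Context: A graph $(V,E)$ has $E\subseteq V\times V$ symmetric (not necessarily irreflexive). A graph $(V,E)$ is an interval graph if it is reflexive and there exist a linear order $(L,<_L)$ and a map $F$ assigning to each $v\in V$ a nonempty interval $F(v)$ of $L$ (a convex subset) such that $v\,E\,u \iff F(v)\cap F(u)\neq\emptyset$. A strict partial order $\prec$ on $V$ is associated to $(V,E)$ if for all $u,v\in V$: $\neg\, u\,E\,v$ iff ($u\prec v$ or $v\prec u$). $(V,E)$ is uniquely orderable if there is a strict partial order $\prec$ associated to it and the only other strict partial order associated to it is the dual (reverse) of $\prec$. For $B\subseteq V$ let $K(B)=\{v\in V\mid \forall b\in B\,(v\,E\,b)\}$ and $R(B)=V\setminus(B\cup K(B))$. A set $B\subseteq V$ is a buried subgraph of $(V,E)$ if: (i) there are $a,b\in B$ with $\neg\, a\,E\,b$; (ii) $K(B)\cap B=\emptyset$ and $R(B)\neq\emptyset$; (iii) for all $b\in B$ and $r\in R(B)$, $\neg\, b\,E\,r$. A graph is connected if any two vertices are joined by a path $v_0\,E\,v_1\,E\cdots E\,v_n$. -}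

module Defs where

open import Level using (0ℓ)
open import Data.Product using (Σ; ∃; ∃-syntax; _×_; _,_)
open import Data.Sum using (_⊎_)
open import Data.Empty using (⊥)
open import Relation.Nullary using (¬_)
open import Relation.Binary.Core using (Rel)
open import Relation.Binary.Definitions using (Symmetric; Reflexive; Irreflexive; Transitive)
open import Relation.Binary.Structures using (IsStrictTotalOrder)
open import Relation.Binary.PropositionalEquality using (_≡_)
open import Relation.Binary.Construct.Closure.ReflexiveTransitive using (Star)
open import Function.Bundles using (_⇔_)

-- A graph is a type V with a symmetric relation E (Symmetric E is a separate hypothesis).

record IsInterval {L : Set} (_<_ : Rel L 0ℓ) (I : L → Set) : Set where
  field
    nonempty : ∃[ x ] I x
    convex   : ∀ x y z → I x → I z → x < y → y < z → I y

record IsIntervalGraph {V : Set} (E : Rel V 0ℓ) : Set₁ where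
  field
    refl      : Reflexive E
    L         : Set
    _<L_      : Rel L 0ℓ
    linear    : IsStrictTotalOrder _≡_ _<L_
    F         : V → L → Set
    interval  : ∀ v → IsInterval _<L_ (F v)
    represent : ∀ u v → (E v u ⇔ (∃[ x ] (F v x × F u x)))

Connected : {A : Set} → Rel A 0ℓ → Set
Connected {A} R = ∀ (u v : A) → Star R u v

record IsAssociated {V : Set} (E : Rel V 0ℓ) (_≺_ : Rel V 0ℓ) : Set where
  field
    irrefl : Irreflexive _≡_ _≺_
    trans  : Transitive _≺_
    assoc  : ∀ u v → ((¬ E u v) ⇔ (u ≺ v ⊎ v ≺ u))

SameRel : {V : Set} → Rel V 0ℓ → Rel V 0ℓ → Set
SameRel R S = ∀ u v → (R u v ⇔ S u v)

Dual : {V : Set} → Rel V 0ℓ → Rel V 0ℓ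
Dual R u v = R v u

UniquelyOrderable : {V : Set} → Rel V 0ℓ → Set₁
UniquelyOrderable {V} E =
  Σ (Rel V 0ℓ) λ ≺ → IsAssociated E ≺ ×
    (∀ (≺' : Rel V 0ℓ) → IsAssociated E ≺' → SameRel ≺' ≺ ⊎ SameRel ≺' (Dual ≺))

K : {V : Set} → Rel V 0ℓ → (V → Set) → V → Set
K E B v = ∀ b → B b → E v b

R : {V : Set} → Rel V 0ℓ → (V → Set) → V → Set
R E B v = ¬ B v × ¬ K E B v

record IsBuried {V : Set} (E : Rel V 0ℓ) (B : V → Set) : Set where
  field
    nonadj  : ∃[ a ] ∃[ b ] (B a × B b × ¬ E a b)
    disjKB  : ∀ v → K E B v → B v → ⊥
    Rne     : ∃[ r ] R E B r
    sep     : ∀ b r → B b → R E B r → ¬ E b r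

HasBuriedSubgraph : {V : Set} → Rel V 0ℓ → Set₁
HasBuriedSubgraph {V} E = Σ (V → Set) λ B → IsBuried E B

W : {V : Set} → Rel V 0ℓ → Set
W {V} E = Σ (V × V) λ { (a , b) → ¬ E a b }

Q : {V : Set} (E : Rel V 0ℓ) → Rel (W E) 0ℓ
Q E ((a , b) , _) ((c , d) , _) = E a c × E b d

ExactlyTwoComponents : {A : Set} → Rel A 0ℓ → Set
ExactlyTwoComponents {A} R =
  ∃[ x ] ∃[ y ] (¬ Star R x y × ∀ z → Star R x z ⊎ Star R y z)

-- An interval representation orders non-adjacent vertices by "lies to the left of", which is an
-- associated order, and it rules out induced 4-cycles. Without induced 4-cycles, Q-adjacent pairs
-- are oriented alike by every associated order, so a pair and its swap lie in different
-- components of (W, Q); with exactly two components, an associated order is determined by how it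
-- orients a single pair. Conversely, the vertices occurring in a component of forward pairs form a
-- buried subgraph unless every other vertex is adjacent to all of them; two distinct components
-- with that property contain pairs through a common vertex, and comparing these pairs forces a
-- vertex out of a component in which it occurs.
module Submission where

open import Defs
open import Level using (0ℓ)
open import Data.Product using (Σ; ∃; ∃-syntax; _×_; _,_; proj₁; proj₂)
open import Data.Sum using (_⊎_; inj₁; inj₂; [_,_]) renaming (swap to ⊎-swap)
open import Data.Empty using (⊥; ⊥-elim)
open import Function using (_∘_; id)
open import Relation.Nullary using (¬_; yes; no)
open import Relation.Nullary.Decidable using (decidable-stable)
open import Relation.Binary.Core using (Rel)
open import Relation.Binary.Definitions using (Symmetric; Reflexive; Transitive; tri<; tri≈; tri>)
open import Relation.Binary.Structures using (IsStrictTotalOrder)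
open import Relation.Binary.PropositionalEquality using (_≡_; refl; sym)
open import Relation.Binary.Construct.Closure.ReflexiveTransitive
  using (Star; ε; _◅_; _◅◅_; gmap; reverse)
open import Function.Bundles using (_⇔_; mk⇔; Equivalence)
open import Axiom.ExcludedMiddle using (ExcludedMiddle)

C4Free : {V : Set} → Rel V 0ℓ → Set
C4Free E = ∀ {a b c d} → ¬ E a b → ¬ E c d → E a c → E c b → E b d → E d a → ⊥

module _ {A : Set} {_∼_ : Rel A 0ℓ} where

  other-component : Symmetric (Star _∼_) → ExactlyTwoComponents _∼_ →
                    ∀ {a b} → ¬ Star _∼_ a b → ∀ c → Star _∼_ a c ⊎ Star _∼_ b c
  other-component symmetric (_ , _ , _ , cover) {a} {b} a≁b c with cover a | cover b | cover c
  ... | inj₁ xa | inj₁ xb | _      = ⊥-elim (a≁b (symmetric xa ◅◅ xb))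
  ... | inj₂ ya | inj₂ yb | _      = ⊥-elim (a≁b (symmetric ya ◅◅ yb))
  ... | inj₁ xa | inj₂ _  | inj₁ xc = inj₁ (symmetric xa ◅◅ xc)
  ... | inj₁ _  | inj₂ yb | inj₂ yc = inj₂ (symmetric yb ◅◅ yc)
  ... | inj₂ ya | inj₁ _  | inj₂ yc = inj₁ (symmetric ya ◅◅ yc)
  ... | inj₂ _  | inj₁ xb | inj₁ xc = inj₂ (symmetric xb ◅◅ xc)

  star-invariant : ∀ {a} (I : A → Set) → (∀ p q → Star _∼_ a p → p ∼ q → I p → I q) →
                   ∀ {p q} → Star _∼_ a p → Star _∼_ p q → I p → I q
  star-invariant I step a⇝p ε         Ip = Ip
  star-invariant I step a⇝p (pq ◅ q⇝) Ip = star-invariant I step (a⇝p ◅◅ pq ◅ ε) q⇝ (step _ _ a⇝p pq Ip)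

module IntervalRepresentation {V : Set} {E : Rel V 0ℓ} (symE : Symmetric E) (G : IsIntervalGraph E)
  where
  open IsIntervalGraph G renaming (refl to reflE)
  open IsStrictTotalOrder linear using (compare) renaming (trans to <-trans; irrefl to <-irrefl)

  meet : ∀ {u v x} → F u x → F v x → E u v
  meet {u} {v} {x} ux vx = Equivalence.from (represent v u) (x , ux , vx)

  meeting-point : ∀ {u v} → E u v → ∃[ x ] (F u x × F v x)
  meeting-point {u} {v} = Equivalence.to (represent v u)

  between : ∀ u {x y z} → F u x → F u z → x <L y → y <L z → F u y
  between u ux uz = IsInterval.convex (interval u) _ _ _ ux uz

  _◁_ : Rel V 0ℓ
  u ◁ v = ∀ {x y} → F u x → F v y → x <L y

  ◁⇒¬E : ∀ {u v} → u ◁ v → ¬ E u v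
  ◁⇒¬E u◁v uv with meeting-point uv
  ... | _ , ux , vx = <-irrefl refl (u◁v ux vx)

  ◁-trans : Transitive _◁_
  ◁-trans {j = v} u◁v v◁w ux wz with IsInterval.nonempty (interval v)
  ... | _ , vy = <-trans (u◁v ux vy) (v◁w vy wz)

  ◁-from-points : ∀ {u v x₀ y₀} → ¬ E u v → F u x₀ → F v y₀ → x₀ <L y₀ → u ◁ v
  ◁-from-points {u} {v} {x₀} {y₀} u≁v ux₀ vy₀ x₀<y₀ {x} {y} ux vy with compare x y
  ... | tri< x<y _ _ = x<y
  ... | tri≈ _ refl _ = ⊥-elim (u≁v (meet ux vy))
  ... | tri> _ _ y<x with compare y₀ x
  ...   | tri< y₀<x _ _ = ⊥-elim (u≁v (meet (between u ux₀ ux x₀<y₀ y₀<x) vy₀))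
  ...   | tri≈ _ refl _ = ⊥-elim (u≁v (meet ux vy₀))
  ...   | tri> _ _ x<y₀ = ⊥-elim (u≁v (meet ux (between v vy vy₀ y<x x<y₀)))

  ¬E⇒◁⊎▷ : ∀ {u v} → ¬ E u v → u ◁ v ⊎ v ◁ u
  ¬E⇒◁⊎▷ {u} {v} u≁v with IsInterval.nonempty (interval u) | IsInterval.nonempty (interval v)
  ... | x , ux | y , vy with compare x y
  ...   | tri< x<y _ _ = inj₁ (◁-from-points u≁v ux vy x<y)
  ...   | tri≈ _ refl _ = ⊥-elim (u≁v (meet ux vy))
  ...   | tri> _ _ y<x = inj₂ (◁-from-points (u≁v ∘ symE) vy ux y<x)

  interval-order : IsAssociated E _◁_
  interval-order = record
    { irrefl = λ { refl u◁u → ◁⇒¬E u◁u reflE }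
    ; trans  = ◁-trans
    ; assoc  = λ u v → mk⇔ ¬E⇒◁⊎▷ [ ◁⇒¬E , (λ v◁u → ◁⇒¬E v◁u ∘ symE) ]
    }

  -- F c and F d each meet F u and F v, hence both contain the points between them.
  common-neighbours-adjacent : ∀ {u v c d} → u ◁ v → E u c → E v c → E u d → E v d → E c d
  common-neighbours-adjacent {c = c} {d} u◁v uc vc ud vd
    with meeting-point uc | meeting-point vc | meeting-point ud | meeting-point vd
  ... | p , up , cp | q , vq , cq | p' , up' , dp' | q' , vq' , dq' with compare p p'
  ...   | tri≈ _ refl _ = meet cp dp'
  ...   | tri< p<p' _ _ = meet (between c cp cq p<p' (u◁v up' vq)) dp'
  ...   | tri> _ _ p'<p = meet cp (between d dp' dq' p'<p (u◁v up vq'))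

  c4-free : C4Free E
  c4-free a≁b c≁d ac cb bd da with ¬E⇒◁⊎▷ a≁b
  ... | inj₁ a◁b = c≁d (common-neighbours-adjacent a◁b ac (symE cb) (symE da) bd)
  ... | inj₂ b◁a = c≁d (common-neighbours-adjacent b◁a (symE cb) ac bd (symE da))

module AssociatedOrder (lem : ExcludedMiddle 0ℓ) {V : Set} {E : Rel V 0ℓ} (symE : Symmetric E)
                       {_≺_ : Rel V 0ℓ} (A : IsAssociated E _≺_) where
  open IsAssociated A

  ≺⇒¬E : ∀ {u v} → u ≺ v → ¬ E u v
  ≺⇒¬E {u} {v} u≺v = Equivalence.from (assoc u v) (inj₁ u≺v)

  ¬E⇒≺⊎≻ : ∀ {u v} → ¬ E u v → u ≺ v ⊎ v ≺ u
  ¬E⇒≺⊎≻ {u} {v} = Equivalence.to (assoc u v)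

  ≺-irrefl : ∀ {u} → ¬ u ≺ u
  ≺-irrefl = irrefl refl

  ≺-asym : ∀ {u v} → u ≺ v → ¬ v ≺ u
  ≺-asym u≺v v≺u = ≺-irrefl (trans u≺v v≺u)

  incomparable⇒E : ∀ {u v} → ¬ u ≺ v → ¬ v ≺ u → E u v
  incomparable⇒E u⊀v v⊀u = decidable-stable lem (λ u≁v → [ u⊀v , v⊀u ] (¬E⇒≺⊎≻ u≁v))

  trichotomy : ∀ u v → E u v ⊎ u ≺ v ⊎ v ≺ u
  trichotomy u v with lem {E u v}
  ... | yes uv = inj₁ uv
  ... | no u≁v = inj₂ (¬E⇒≺⊎≻ u≁v)

  dual-order : IsAssociated E (Dual _≺_)
  dual-order = record
    { irrefl = irrefl ∘ sym
    ; trans  = λ v≺u w≺v → trans w≺v v≺u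
    ; assoc  = λ u v → mk⇔ (⊎-swap ∘ ¬E⇒≺⊎≻) (Equivalence.from (assoc u v) ∘ ⊎-swap)
    }

  same-comparability⇒associated : ∀ {_≺'_ : Rel V 0ℓ} → Transitive _≺'_ →
    (∀ {u v} → u ≺' v → u ≺ v ⊎ v ≺ u) → (∀ {u v} → u ≺ v → u ≺' v ⊎ v ≺' u) →
    IsAssociated E _≺'_
  same-comparability⇒associated {_≺'_} trans' ≺'⇒comparable ≺⇒comparable' = record
    { irrefl = λ { refl u≺'u → [ ≺-irrefl , ≺-irrefl ] (≺'⇒comparable u≺'u) }
    ; trans  = trans'
    ; assoc  = λ u v → mk⇔ (comparable' ∘ ¬E⇒≺⊎≻) (Equivalence.from (assoc u v) ∘ comparable)
    }
    where
    comparable : ∀ {u v} → u ≺' v ⊎ v ≺' u → u ≺ v ⊎ v ≺ u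
    comparable = [ ≺'⇒comparable , ⊎-swap ∘ ≺'⇒comparable ]
    comparable' : ∀ {u v} → u ≺ v ⊎ v ≺ u → u ≺' v ⊎ v ≺' u
    comparable' = [ ≺⇒comparable' , ⊎-swap ∘ ≺⇒comparable' ]

  reversed-pair⇒≉ : ∀ {_≺'_ : Rel V 0ℓ} {u v} → u ≺ v → v ≺' u → ¬ SameRel _≺'_ _≺_
  reversed-pair⇒≉ u≺v v≺'u same = ≺-asym u≺v (Equivalence.to (same _ _) v≺'u)

  kept-pair⇒≉dual : ∀ {_≺'_ : Rel V 0ℓ} {u v} → u ≺ v → u ≺' v → ¬ SameRel _≺'_ (Dual _≺_)
  kept-pair⇒≉dual u≺v u≺'v same = ≺-asym u≺v (Equivalence.to (same _ _) u≺'v)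

-- A buried B can be flipped: if some vertex outside B lies between two vertices of B, lift all
-- such vertices above B; otherwise reverse ≺ on B.
module BuriedSubgraphs (lem : ExcludedMiddle 0ℓ) {V : Set} {E : Rel V 0ℓ} (symE : Symmetric E) where

  module Flip {_≺_ : Rel V 0ℓ} (A : IsAssociated E _≺_) {B : V → Set} (buried : IsBuried E B) where
    open IsAssociated A using (trans; assoc)
    open AssociatedOrder lem symE A
    open IsBuried buried

    record Enclosed (v : V) : Set where
      field
        outside : ¬ B v
        lo hi   : V
        lo∈B    : B lo
        hi∈B    : B hi
        lo≺v    : lo ≺ v
        v≺hi    : v ≺ hi
    open Enclosed

    comparable⇒R : ∀ {b v} → ¬ B v → B b → b ≺ v ⊎ v ≺ b → R E B v
    comparable⇒R v∉B b∈B b≶v = v∉B , λ v∈K → Equivalence.from (assoc _ _) b≶v (symE (v∈K _ b∈B))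

    above-one⇒above-all : ∀ {b v b'} → ¬ B v → ¬ Enclosed v → B b → b ≺ v → B b' → b' ≺ v
    above-one⇒above-all v∉B unenclosed b∈B b≺v b'∈B
      with ¬E⇒≺⊎≻ (sep _ _ b'∈B (comparable⇒R v∉B b∈B (inj₁ b≺v)))
    ... | inj₁ b'≺v = b'≺v
    ... | inj₂ v≺b' = ⊥-elim (unenclosed (record
          { outside = v∉B ; lo∈B = b∈B ; hi∈B = b'∈B ; lo≺v = b≺v ; v≺hi = v≺b' }))

    below-one⇒below-all : ∀ {b v b'} → ¬ B v → ¬ Enclosed v → B b → v ≺ b → B b' → v ≺ b'
    below-one⇒below-all v∉B unenclosed b∈B v≺b b'∈B
      with ¬E⇒≺⊎≻ (sep _ _ b'∈B (comparable⇒R v∉B b∈B (inj₂ v≺b)))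
    ... | inj₁ b'≺v = ⊥-elim (unenclosed (record
          { outside = v∉B ; lo∈B = b'∈B ; hi∈B = b∈B ; lo≺v = b'≺v ; v≺hi = v≺b }))
    ... | inj₂ v≺b' = v≺b'

    ordered-pair-in-B : ∃[ a ] ∃[ b ] (B a × B b × a ≺ b)
    ordered-pair-in-B with nonadj
    ... | a , b , a∈B , b∈B , a≁b with ¬E⇒≺⊎≻ a≁b
    ...   | inj₁ a≺b = a , b , a∈B , b∈B , a≺b
    ...   | inj₂ b≺a = b , a , b∈B , a∈B , b≺a

    ordered-pair-across : ∃[ u ] ∃[ v ] (¬ (B u × B v) × u ≺ v)
    ordered-pair-across with nonadj | Rne
    ... | a , _ , a∈B , _ | r , r∈R with ¬E⇒≺⊎≻ (sep a r a∈B r∈R)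
    ...   | inj₁ a≺r = a , r , proj₁ r∈R ∘ proj₂ , a≺r
    ...   | inj₂ r≺a = r , a , proj₁ r∈R ∘ proj₁ , r≺a

    _≺↑_ : Rel V 0ℓ
    u ≺↑ v = (B u × Enclosed v) ⊎ (u ≺ v × ¬ (Enclosed u × B v))

    ≺↑-trans : Transitive _≺↑_
    ≺↑-trans (inj₁ (_ , v-enc)) (inj₁ (v∈B , _)) = ⊥-elim (outside v-enc v∈B)
    ≺↑-trans {u} {v} {w} (inj₁ (u∈B , v-enc)) (inj₂ (v≺w , ¬v-enc×w∈B))
      with lem {Enclosed w} | lem {B w}
    ... | yes w-enc | _      = inj₁ (u∈B , w-enc)
    ... | no _      | yes w∈B = ⊥-elim (¬v-enc×w∈B (v-enc , w∈B))
    ... | no w-unenc | no w∉B =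
      inj₂ ( above-one⇒above-all w∉B w-unenc (lo∈B v-enc) (trans (lo≺v v-enc) v≺w) u∈B
           , λ { (u-enc , _) → outside u-enc u∈B } )
    ≺↑-trans {u} {v} {w} (inj₂ (u≺v , ¬u-enc×v∈B)) (inj₁ (v∈B , w-enc))
      with lem {B u} | lem {Enclosed u}
    ... | yes u∈B | _       = inj₁ (u∈B , w-enc)
    ... | no _    | yes u-enc = ⊥-elim (¬u-enc×v∈B (u-enc , v∈B))
    ... | no u∉B  | no u-unenc =
      inj₂ ( trans (below-one⇒below-all u∉B u-unenc v∈B u≺v (lo∈B w-enc)) (lo≺v w-enc)
           , u-unenc ∘ proj₁ )
    ≺↑-trans {u} {v} {w} (inj₂ (u≺v , ¬u-enc×v∈B)) (inj₂ (v≺w , ¬v-enc×w∈B)) =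
      inj₂ (trans u≺v v≺w , λ { (u-enc , w∈B) → v-placed u-enc w∈B })
      where
      v-placed : Enclosed u → B w → ⊥
      v-placed u-enc w∈B with lem {B v} | lem {Enclosed v}
      ... | yes v∈B | _       = ¬u-enc×v∈B (u-enc , v∈B)
      ... | no _    | yes v-enc = ¬v-enc×w∈B (v-enc , w∈B)
      ... | no v∉B  | no v-unenc = ≺-irrefl
        (trans (trans (lo≺v u-enc) u≺v) (below-one⇒below-all v∉B v-unenc w∈B v≺w (lo∈B u-enc)))

    ≺↑⇒comparable : ∀ {u v} → u ≺↑ v → u ≺ v ⊎ v ≺ u
    ≺↑⇒comparable (inj₁ (u∈B , v-enc)) =
      ¬E⇒≺⊎≻ (sep _ _ u∈B (comparable⇒R (outside v-enc) (lo∈B v-enc) (inj₁ (lo≺v v-enc))))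
    ≺↑⇒comparable (inj₂ (u≺v , _)) = inj₁ u≺v

    ≺⇒≺↑-comparable : ∀ {u v} → u ≺ v → u ≺↑ v ⊎ v ≺↑ u
    ≺⇒≺↑-comparable {u} {v} u≺v with lem {Enclosed u × B v}
    ... | yes (u-enc , v∈B)  = inj₂ (inj₁ (v∈B , u-enc))
    ... | no ¬u-enc×v∈B     = inj₁ (inj₂ (u≺v , ¬u-enc×v∈B))

    lift-enclosed-order : IsAssociated E _≺↑_
    lift-enclosed-order = same-comparability⇒associated ≺↑-trans ≺↑⇒comparable ≺⇒≺↑-comparable

    lift-enclosed-≉ : ∀ {r} → Enclosed r → ¬ (SameRel _≺↑_ _≺_ ⊎ SameRel _≺↑_ (Dual _≺_))
    lift-enclosed-≉ r-enc with ordered-pair-in-B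
    ... | a , b , a∈B , b∈B , a≺b =
      [ reversed-pair⇒≉ (v≺hi r-enc) (inj₁ (hi∈B r-enc , r-enc))
      , kept-pair⇒≉dual a≺b (inj₂ (a≺b , λ { (a-enc , _) → outside a-enc a∈B })) ]

    module _ (nothing-enclosed : ∀ v → ¬ Enclosed v) where

      _≺ᴮ_ : Rel V 0ℓ
      u ≺ᴮ v = (B u × B v × v ≺ u) ⊎ (¬ (B u × B v) × u ≺ v)

      ≺ᴮ-trans : Transitive _≺ᴮ_
      ≺ᴮ-trans (inj₁ (u∈B , _ , v≺u)) (inj₁ (_ , w∈B , w≺v)) = inj₁ (u∈B , w∈B , trans w≺v v≺u)
      ≺ᴮ-trans {u} {v} {w} (inj₁ (u∈B , v∈B , _)) (inj₂ (¬v∈B×w∈B , v≺w)) =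
        inj₂ (w∉B ∘ proj₂ , above-one⇒above-all w∉B (nothing-enclosed w) v∈B v≺w u∈B)
        where
        w∉B : ¬ B w
        w∉B w∈B = ¬v∈B×w∈B (v∈B , w∈B)
      ≺ᴮ-trans {u} {v} {w} (inj₂ (¬u∈B×v∈B , u≺v)) (inj₁ (v∈B , w∈B , _)) =
        inj₂ (u∉B ∘ proj₁ , below-one⇒below-all u∉B (nothing-enclosed u) v∈B u≺v w∈B)
        where
        u∉B : ¬ B u
        u∉B u∈B = ¬u∈B×v∈B (u∈B , v∈B)
      ≺ᴮ-trans {u} {v} {w} (inj₂ (¬u∈B×v∈B , u≺v)) (inj₂ (¬v∈B×w∈B , v≺w)) =
        inj₂ (v-enclosed , trans u≺v v≺w)
        where
        v-enclosed : ¬ (B u × B w)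
        v-enclosed (u∈B , w∈B) = nothing-enclosed v (record
          { outside = λ v∈B → ¬u∈B×v∈B (u∈B , v∈B)
          ; lo∈B = u∈B ; hi∈B = w∈B ; lo≺v = u≺v ; v≺hi = v≺w })

      ≺ᴮ⇒comparable : ∀ {u v} → u ≺ᴮ v → u ≺ v ⊎ v ≺ u
      ≺ᴮ⇒comparable (inj₁ (_ , _ , v≺u)) = inj₂ v≺u
      ≺ᴮ⇒comparable (inj₂ (_ , u≺v))     = inj₁ u≺v

      ≺⇒≺ᴮ-comparable : ∀ {u v} → u ≺ v → u ≺ᴮ v ⊎ v ≺ᴮ u
      ≺⇒≺ᴮ-comparable {u} {v} u≺v with lem {B u × B v}
      ... | yes (u∈B , v∈B) = inj₂ (inj₁ (v∈B , u∈B , u≺v))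
      ... | no ¬u∈B×v∈B    = inj₁ (inj₂ (¬u∈B×v∈B , u≺v))

      reverse-on-B-order : IsAssociated E _≺ᴮ_
      reverse-on-B-order = same-comparability⇒associated ≺ᴮ-trans ≺ᴮ⇒comparable ≺⇒≺ᴮ-comparable

      reverse-on-B-≉ : ¬ (SameRel _≺ᴮ_ _≺_ ⊎ SameRel _≺ᴮ_ (Dual _≺_))
      reverse-on-B-≉ with ordered-pair-in-B | ordered-pair-across
      ... | a , b , a∈B , b∈B , a≺b | u , v , ¬u∈B×v∈B , u≺v =
        [ reversed-pair⇒≉ a≺b (inj₁ (b∈B , a∈B , a≺b)) , kept-pair⇒≉dual u≺v (inj₂ (¬u∈B×v∈B , u≺v)) ]

  uniquelyOrderable⇒noBuried : UniquelyOrderable E → ¬ HasBuriedSubgraph E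
  uniquelyOrderable⇒noBuried (_≺_ , A , unique) (B , buried) with lem {∃ (Flip.Enclosed A buried)}
  ... | yes (_ , r-enc) = lift-enclosed-≉ r-enc (unique _ lift-enclosed-order)
    where open Flip A buried
  ... | no none = reverse-on-B-≉ nothing-enclosed (unique _ (reverse-on-B-order nothing-enclosed))
    where
    open Flip A buried
    nothing-enclosed : ∀ v → ¬ Enclosed v
    nothing-enclosed v v-enc = none (v , v-enc)

module PairGraph (lem : ExcludedMiddle 0ℓ) {V : Set} {E : Rel V 0ℓ}
                 (symE : Symmetric E) (reflE : Reflexive E) (c4 : C4Free E) where

  left right : W E → V
  left ((a , _) , _) = a
  right ((_ , b) , _) = b

  swap : W E → W E
  swap ((a , b) , a≁b) = (b , a) , a≁b ∘ symE

  _~_ : Rel (W E) 0ℓ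
  _~_ = Star (Q E)

  Q-sym : Symmetric (Q E)
  Q-sym (ac , bd) = symE ac , symE bd

  ~-sym : Symmetric _~_
  ~-sym = reverse (λ {x} {y} → Q-sym {x} {y})

  swap-~ : ∀ {x y} → x ~ y → swap x ~ swap y
  swap-~ = gmap swap (λ { (ac , bd) → bd , ac })

  ~-swap² : ∀ {x} → x ~ swap (swap x)
  ~-swap² = (reflE , reflE) ◅ ε

  ~-swap-reflect : ∀ {x y} → swap x ~ swap y → x ~ y
  ~-swap-reflect s = ~-swap² ◅◅ swap-~ s ◅◅ ~-sym ~-swap²

  Occurs : W E → V → Set
  Occurs x v = ∃[ P ] (x ~ P × (left P ≡ v ⊎ right P ≡ v))

  occurs-left : ∀ {x P} → x ~ P → Occurs x (left P)
  occurs-left {P = P} x~P = P , x~P , inj₁ refl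

  occurs-right : ∀ {x P} → x ~ P → Occurs x (right P)
  occurs-right {P = P} x~P = P , x~P , inj₂ refl

  occurs-swap : ∀ {x v} → Occurs x v → Occurs (swap x) v
  occurs-swap (_ , x~P , inj₁ refl) = occurs-right (swap-~ x~P)
  occurs-swap (_ , x~P , inj₂ refl) = occurs-left (swap-~ x~P)

  occurs-unswap : ∀ {x v} → Occurs (swap x) v → Occurs x v
  occurs-unswap occ with occurs-swap occ
  ... | P , s , at = P , ~-swap² ◅◅ s , at

  module Oriented {_≺_ : Rel V 0ℓ} (A : IsAssociated E _≺_) where
    open IsAssociated A using (trans)
    open AssociatedOrder lem symE A public

    Forward : W E → Set
    Forward P = left P ≺ right P

    forward-pair : W E → Σ (W E) Forward
    forward-pair P with ¬E⇒≺⊎≻ (proj₂ P)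
    ... | inj₁ p≺q = P , p≺q
    ... | inj₂ q≺p = swap P , q≺p

    -- Otherwise a, c, b, d would be an induced 4-cycle.
    ≺-transfer : ∀ {a b c d} → E a c → E b d → ¬ E c d → a ≺ b → c ≺ d
    ≺-transfer {a} {b} {c} {d} ac bd c≁d a≺b with ¬E⇒≺⊎≻ c≁d
    ... | inj₁ c≺d = c≺d
    ... | inj₂ d≺c = ⊥-elim (c4 (≺⇒¬E a≺b) c≁d ac cb bd da)
      where
      da : E d a
      da = incomparable⇒E (λ d≺a → ≺⇒¬E (trans d≺a a≺b) (symE bd)) (λ a≺d → ≺⇒¬E (trans a≺d d≺c) ac)
      cb : E c b
      cb = incomparable⇒E (λ c≺b → ≺⇒¬E (trans d≺c c≺b) (symE bd)) (λ b≺c → ≺⇒¬E (trans a≺b b≺c) ac)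

    ~-preserves-forward : ∀ {P P'} → P ~ P' → Forward P → Forward P'
    ~-preserves-forward ε = id
    ~-preserves-forward (_◅_ {j = P'} (ac , bd) s) = ~-preserves-forward s ∘ ≺-transfer ac bd (proj₂ P')

    forward-≁-swap : ∀ {x} → Forward x → ¬ x ~ swap x
    forward-≁-swap fx x~swap = ≺-asym fx (~-preserves-forward x~swap fx)

    module _ {x : W E} (fx : Forward x) where

      left-escape : ∀ {a b c} (b≁c : ¬ E b c) (a≁c : ¬ E a c) → a ≺ b →
                    x ~ ((b , c) , b≁c) → ¬ x ~ ((a , c) , a≁c) → ¬ Occurs x a
      left-escape {a} {b} {c} b≁c a≁c a≺b x~bc x≁ac = excluded
        where
        -- Along the component, a stays left of the pair, and replacing the left end by a stays
        -- in the component of (a, c).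
        Left-of-a : W E → Set
        Left-of-a P = a ≺ left P × Σ (¬ E a (right P)) λ a≁q → ((a , right P) , a≁q) ~ ((a , c) , a≁c)

        step : ∀ P P' → x ~ P → Q E P P' → Left-of-a P → Left-of-a P'
        step P P' x~P (pp' , qq') (a≺p , a≁q , aq~ac) = placed (trichotomy a (left P'))
          where
          x~P' : x ~ P'
          x~P' = x~P ◅◅ (pp' , qq') ◅ ε
          placed : E a (left P') ⊎ a ≺ left P' ⊎ left P' ≺ a → Left-of-a P'
          placed (inj₁ ap')         = ⊥-elim (x≁ac (x~P' ◅◅ (symE ap' , symE qq') ◅ aq~ac))
          placed (inj₂ (inj₁ a≺p')) =
            a≺p' , ≺⇒¬E (trans a≺p' (~-preserves-forward x~P' fx)) , (reflE , symE qq') ◅ aq~ac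
          placed (inj₂ (inj₂ p'≺a)) = ⊥-elim (≺⇒¬E (trans p'≺a a≺p) (symE pp'))

        on-component : ∀ {P} → x ~ P → Left-of-a P
        on-component x~P = star-invariant Left-of-a step x~bc (~-sym x~bc ◅◅ x~P) (a≺b , a≁c , ε)

        excluded : ¬ Occurs x a
        excluded (P , x~P , inj₁ refl) = ≺-irrefl (proj₁ (on-component x~P))
        excluded (P , x~P , inj₂ refl) = ≺-asym (proj₁ (on-component x~P)) (~-preserves-forward x~P fx)

      adjacent-left⇒adjacent-right : ∀ {v P} → ¬ Occurs x v → x ~ P → E v (left P) → E v (right P)
      adjacent-left⇒adjacent-right {v} {P} v∉ x~P vp = incomparable⇒E
        (λ v≺q → v∉ (occurs-left {P = (v , right P) , ≺⇒¬E v≺q} (x~P ◅◅ (symE vp , reflE) ◅ ε)))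
        (λ q≺v → ≺⇒¬E (trans (~-preserves-forward x~P fx) q≺v) (symE vp))

  module Components {_≺_ : Rel V 0ℓ} (A : IsAssociated E _≺_) where
    open IsAssociated A using (trans)
    open Oriented A public
    private module Reversed = Oriented dual-order

    module _ {x : W E} (fx : Forward x) where

      right-escape : ∀ {a b c} (a≁b : ¬ E a b) (a≁c : ¬ E a c) → b ≺ c →
                     x ~ ((a , b) , a≁b) → ¬ x ~ ((a , c) , a≁c) → ¬ Occurs x c
      right-escape a≁b a≁c b≺c x~ab x≁ac =
        Reversed.left-escape fx (a≁b ∘ symE) (a≁c ∘ symE) b≺c (swap-~ x~ab) (x≁ac ∘ ~-swap-reflect)
        ∘ occurs-swap

      adjacent-right⇒adjacent-left : ∀ {v P} → ¬ Occurs x v → x ~ P → E v (right P) → E v (left P)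
      adjacent-right⇒adjacent-left v∉ x~P =
        Reversed.adjacent-left⇒adjacent-right fx (v∉ ∘ occurs-unswap) (swap-~ x~P)

      adjacent-left-step : ∀ {v} → ¬ Occurs x v →
                           ∀ P P' → x ~ P → Q E P P' → E v (left P) → E v (left P')
      adjacent-left-step {v} v∉ P P' x~P (pp' , qq') vp = incomparable⇒E
        (λ v≺p' → v∉ (occurs-left {P = (v , right P') , ≺⇒¬E (trans v≺p' (~-preserves-forward x~P' fx))}
                                  (x~P ◅◅ (symE vp , qq') ◅ ε)))
        (λ p'≺v → v∉ (occurs-right {P = (left P' , v) , ≺⇒¬E p'≺v}
                                   (x~P ◅◅ (pp' , symE vq) ◅ ε)))
        where
        x~P' : x ~ P'
        x~P' = x~P ◅◅ (pp' , qq') ◅ ε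
        vq : E v (right P)
        vq = adjacent-left⇒adjacent-right fx v∉ x~P vp

      adjacent-at-occurrence : ∀ {v b P} → ¬ Occurs x v → x ~ P → left P ≡ b ⊎ right P ≡ b →
                               E v b ⇔ E v (left P)
      adjacent-at-occurrence _  _   (inj₁ refl) = mk⇔ id id
      adjacent-at-occurrence v∉ x~P (inj₂ refl) =
        mk⇔ (adjacent-right⇒adjacent-left v∉ x~P) (adjacent-left⇒adjacent-right fx v∉ x~P)

      adjacent-to-occurring : ∀ {v b b'} → ¬ Occurs x v → Occurs x b → Occurs x b' → E v b → E v b'
      adjacent-to-occurring v∉ (P , x~P , P∋b) (P' , x~P' , P'∋b') vb =
        Equivalence.from (adjacent-at-occurrence v∉ x~P' P'∋b')
          (star-invariant _ (adjacent-left-step v∉) x~P (~-sym x~P ◅◅ x~P')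
            (Equivalence.to (adjacent-at-occurrence v∉ x~P P∋b) vb))

      component-buried : ∃ (R E (Occurs x)) → IsBuried E (Occurs x)
      component-buried r = record
        { nonadj = left x , right x , occurs-left ε , occurs-right ε , proj₂ x
        ; disjKB = disjoint
        ; Rne    = r
        ; sep    = λ b r b∈ (r∉ , r∉K) br → r∉K (λ b' b'∈ → adjacent-to-occurring r∉ b∈ b'∈ (symE br))
        }
        where
        disjoint : ∀ v → K E (Occurs x) v → ¬ Occurs x v
        disjoint _ v∈K (P , x~P , inj₁ refl) = proj₂ P (v∈K _ (occurs-right x~P))
        disjoint _ v∈K (P , x~P , inj₂ refl) = proj₂ P (symE (v∈K _ (occurs-left x~P)))

    Saturated : W E → Set
    Saturated x = ∀ v → Occurs x v ⊎ K E (Occurs x) v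

    noBuried⇒saturated : ¬ HasBuriedSubgraph E → ∀ {x} → Forward x → Saturated x
    noBuried⇒saturated noB {x} fx v with lem {Occurs x v} | lem {K E (Occurs x) v}
    ... | yes v∈  | _       = inj₁ v∈
    ... | no _    | yes v∈K = inj₂ v∈K
    ... | no v∉   | no v∉K  = ⊥-elim (noB (Occurs x , component-buried fx (v , v∉ , v∉K)))

    saturated-covers : ∀ {x z P} → Saturated x → ¬ x ~ z → z ~ P →
                       Occurs x (left P) × Occurs x (right P)
    saturated-covers {x} {P = P} satx x≁z z~P with satx (left P) | satx (right P)
    ... | inj₁ p∈  | inj₁ q∈  = p∈ , q∈
    ... | inj₁ p∈  | inj₂ q∈K = ⊥-elim (proj₂ P (symE (q∈K _ p∈)))
    ... | inj₂ p∈K | inj₁ q∈  = ⊥-elim (proj₂ P (p∈K _ q∈))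
    ... | inj₂ p∈K | inj₂ q∈K =
      ⊥-elim (x≁z (~-sym (z~P ◅◅ (p∈K _ (occurs-left ε) , q∈K _ (occurs-right ε)) ◅ ε)))

    shared-left-end : ∀ {x z c d e} {c≁e : ¬ E c e} {c≁d : ¬ E c d} →
                      Forward x → Saturated x → ¬ x ~ z →
                      x ~ ((c , e) , c≁e) → z ~ ((c , d) , c≁d) → e ≺ d → ⊥
    shared-left-end fx satx x≁z x~ce z~cd e≺d =
      right-escape fx _ _ e≺d x~ce (λ x~cd → x≁z (x~cd ◅◅ ~-sym z~cd))
        (proj₂ (saturated-covers satx x≁z z~cd))

    right-end-meets-left-end : ∀ {x c d e} {c≁d : ¬ E c d} {e≁c : ¬ E e c} →
                               Forward x → Saturated x → Saturated ((c , d) , c≁d) →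
                               ¬ x ~ ((c , d) , c≁d) → x ~ ((e , c) , e≁c) → c ≺ d → ⊥
    right-end-meets-left-end {x} {c} {d} {e} {c≁d} fx satx satz x≁z x~ec c≺d
      with lem {((c , d) , c≁d) ~ ((e , d) , ≺⇒¬E (trans (~-preserves-forward x~ec fx) c≺d))}
    ... | yes z~ed = shared-left-end fx satx x≁z x~ec z~ed c≺d
    ... | no z≁ed  = left-escape c≺d c≁d _ (~-preserves-forward x~ec fx) ε z≁ed
                       (proj₁ (saturated-covers satz (x≁z ∘ ~-sym) x~ec))

    two-saturated-components : ∀ {x z} → Forward x → Forward z → Saturated x → Saturated z → ¬ x ~ z → ⊥
    two-saturated-components {x} {(c , d) , c≁d} fx c≺d satx satz x≁z
      with proj₁ (saturated-covers satx x≁z ε)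
    ... | ((_ , e) , c≁e) , x~ce , inj₁ refl with trichotomy e d
    ...   | inj₁ ed          = x≁z (x~ce ◅◅ (reflE , ed) ◅ ε)
    ...   | inj₂ (inj₁ e≺d) = shared-left-end fx satx x≁z x~ce ε e≺d
    ...   | inj₂ (inj₂ d≺e) = shared-left-end c≺d satz (x≁z ∘ ~-sym) ε x~ce d≺e
    two-saturated-components fx c≺d satx satz x≁z | _ , x~ec , inj₂ refl =
      right-end-meets-left-end fx satx satz x≁z x~ec c≺d

    noBuried⇒twoComponents : ∃[ a ] ∃[ b ] ¬ E a b → ¬ HasBuriedSubgraph E → ExactlyTwoComponents (Q E)
    noBuried⇒twoComponents (a , b , a≁b) noB = x , swap x , forward-≁-swap {x} fx , cover
      where
      x : W E
      x = proj₁ (forward-pair ((a , b) , a≁b))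
      fx : Forward x
      fx = proj₂ (forward-pair ((a , b) , a≁b))

      connected : ∀ z → Forward z → x ~ z
      connected z fz = decidable-stable lem
        (two-saturated-components fx fz (noBuried⇒saturated noB fx) (noBuried⇒saturated noB fz))

      cover : ∀ z → x ~ z ⊎ swap x ~ z
      cover z with ¬E⇒≺⊎≻ (proj₂ z)
      ... | inj₁ fz = inj₁ (connected z fz)
      ... | inj₂ bz = inj₂ (swap-~ (connected (swap z) bz) ◅◅ ~-sym ~-swap²)

  module _ {_≺_ _≺'_ : Rel V 0ℓ} (A : IsAssociated E _≺_) (A' : IsAssociated E _≺'_) where
    private
      module O  = Oriented A
      module O' = Oriented A'

    ⊆-if-forward-at : ExactlyTwoComponents (Q E) → ∀ {x} → O.Forward x → O'.Forward x →
                      ∀ {u v} → u ≺' v → u ≺ v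
    ⊆-if-forward-at two {x} fx fx' {u} {v} u≺'v
      with other-component ~-sym two (O.forward-≁-swap {x} fx) ((u , v) , O'.≺⇒¬E u≺'v)
    ... | inj₁ x~uv  = O.~-preserves-forward x~uv fx
    ... | inj₂ sx~uv = ⊥-elim (O'.≺-asym fx' (O'.~-preserves-forward (~-sym sx~uv) u≺'v))

  twoComponents⇒uniquelyOrderable : ∀ {_≺_} → IsAssociated E _≺_ → ExactlyTwoComponents (Q E) →
                                    UniquelyOrderable E
  twoComponents⇒uniquelyOrderable {_≺_} A two = _≺_ , A , unique
    where
    open Oriented A
    x : W E
    x = proj₁ (forward-pair (proj₁ two))
    fx : Forward x
    fx = proj₂ (forward-pair (proj₁ two))

    unique : ∀ _≺'_ → IsAssociated E _≺'_ → SameRel _≺'_ _≺_ ⊎ SameRel _≺'_ (Dual _≺_)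
    unique _ A' with AssociatedOrder.¬E⇒≺⊎≻ lem symE A' (proj₂ x)
    ... | inj₁ fx' = inj₁ λ _ _ →
      mk⇔ (⊆-if-forward-at A A' two {x} fx fx') (⊆-if-forward-at A' A two {x} fx' fx)
    ... | inj₂ bx' = inj₂ λ _ _ →
      mk⇔ (⊆-if-forward-at dual-order A' two {swap x} fx bx')
          (⊆-if-forward-at A' dual-order two {swap x} bx' fx)

theorem1 : ExcludedMiddle 0ℓ → (V : Set) (E : Rel V 0ℓ) → Symmetric E →
    IsIntervalGraph E → Connected E → (∃[ a ] ∃[ b ] ¬ E a b) →
    (UniquelyOrderable E ⇔ (¬ HasBuriedSubgraph E)) ×
    ((¬ HasBuriedSubgraph E) ⇔ ExactlyTwoComponents (Q E))
theorem1 lem _ E symE G _ nonEdge =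
  mk⇔ uniquelyOrderable⇒noBuried (twoComponents⇒UO ∘ noBuried⇒twoComponents nonEdge) ,
  mk⇔ (noBuried⇒twoComponents nonEdge) (uniquelyOrderable⇒noBuried ∘ twoComponents⇒UO)
  where
  open IntervalRepresentation symE G
  open BuriedSubgraphs lem symE
  open PairGraph lem symE (IsIntervalGraph.refl G) c4-free
  open Components interval-order

  twoComponents⇒UO : ExactlyTwoComponents (Q E) → UniquelyOrderable E
  twoComponents⇒UO = twoComponents⇒uniquelyOrderable interval-order
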